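{- Let $k$ be a positive integer and let $G$ be a connected graph without $k$-suppressible vertices. If $\mathrm{ola}^+(G)\le k$, then $G$ has at most $5k+2$ vertices and at most $6k+1$ edges.
   Context: All graphs are finite, without loops or parallel edges. A linear arrangement of $G=(V,E)$ is a bijection $\alpha:V\to\{1,\dots,|V|\}$; net cost $\mathrm{nc}(\alpha,G)=\sum_{uv\in E}(|\alpha(u)-\alpha(v)|-1)$; $\mathrm{ola}^+(G)$ is the minimum net cost. An edge $e$ is a bridge if $G-e$ has more components than $G$. For a connected graph $G$ and positive integer $k$, a bridge $e$ is $k$-separating if both connected components of $G-e$ have more than $k$ vertices. A vertex $v$ of degree 2 with neighbors $u_1,u_2$ such that $u_1u_2\notin E(G)$ is $k$-suppressible if both edges $vu_1,vu_2$ are $k$-separating bridges. -}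

module Defs where

open import Data.Nat using (ℕ; zero; suc; _+_; _∸_; _<_; _≤_; _<ᵇ_; ∣_-_∣)
open import Data.Fin using (Fin; toℕ)
open import Data.Fin.Permutation using (Permutation′; _⟨$⟩ʳ_)
open import Data.Bool using (Bool; true; false; _∧_; if_then_else_)
open import Data.List using (List; map; allFin)
open import Data.Nat.ListAction using (sum)
open import Data.Product using (Σ; ∃; ∃-syntax; _×_; _,_)
open import Data.Sum using (_⊎_)
open import Relation.Binary.PropositionalEquality using (_≡_; _≢_)
open import Relation.Nullary using (¬_)
open import Function.Definitions using (Injective)

record Graph : Set where
  field
    n     : ℕ
    adj   : Fin n → Fin n → Bool
    sym   : ∀ x y → adj x y ≡ adj y x
    irrefl : ∀ x → adj x x ≡ false
open Graph public

Vertex : Graph → Set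
Vertex G = Fin (n G)

Adj : (G : Graph) → Vertex G → Vertex G → Set
Adj G x y = adj G x y ≡ true

edgeSum : (G : Graph) → (Vertex G → Vertex G → ℕ) → ℕ
edgeSum G f = sum (map (λ i → sum (map (λ j →
  if (toℕ i <ᵇ toℕ j) ∧ adj G i j then f i j else 0) (allFin (n G)))) (allFin (n G)))

numEdges : Graph → ℕ
numEdges G = edgeSum G (λ _ _ → 1)

-- linear arrangement: bijection V → {1..|V|} (here Fin |V|, shift by one is irrelevant)
Arrangement : Graph → Set
Arrangement G = Permutation′ (n G)

netCost : (G : Graph) → Arrangement G → ℕ
netCost G α = edgeSum G (λ u v → ∣ toℕ (α ⟨$⟩ʳ u) - toℕ (α ⟨$⟩ʳ v) ∣ ∸ 1)

IsOlaPlus : Graph → ℕ → Set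
IsOlaPlus G m = (∃[ α ] netCost G α ≡ m) × (∀ α → m ≤ netCost G α)

data Reach (G : Graph) : Vertex G → Vertex G → Set where
  here : ∀ {x} → Reach G x x
  step : ∀ {x y z} → Adj G x y → Reach G y z → Reach G x z

Connected : Graph → Set
Connected G = ∀ x y → Reach G x y

SamePair : ∀ {m} → Fin m → Fin m → Fin m → Fin m → Set
SamePair x y u v = (x ≡ u × y ≡ v) ⊎ (x ≡ v × y ≡ u)

data ReachMinus (G : Graph) (u v : Vertex G) : Vertex G → Vertex G → Set where
  here : ∀ {x} → ReachMinus G u v x x
  step : ∀ {x y z} → Adj G x y → ¬ SamePair x y u v →
         ReachMinus G u v y z → ReachMinus G u v x z

-- the edge uv is a bridge: removing it disconnects u from v
-- (equivalently G − uv has more components than G)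
IsBridge : (G : Graph) → Vertex G → Vertex G → Set
IsBridge G u v = Adj G u v × ¬ ReachMinus G u v u v

BigComponent : (G : Graph) → ℕ → Vertex G → Vertex G → Vertex G → Set
BigComponent G k u v x =
  Σ (Fin (suc k) → Vertex G) λ f →
    Injective _≡_ _≡_ f × (∀ i → ReachMinus G u v x (f i))

KSeparating : (G : Graph) → ℕ → Vertex G → Vertex G → Set
KSeparating G k u v =
  IsBridge G u v × BigComponent G k u v u × BigComponent G k u v v

KSuppressible : (G : Graph) → ℕ → Vertex G → Set
KSuppressible G k v =
  Σ (Vertex G) λ u₁ → Σ (Vertex G) λ u₂ →
    u₁ ≢ u₂ × Adj G v u₁ × Adj G v u₂ ×
    (∀ w → Adj G v w → w ≡ u₁ ⊎ w ≡ u₂) ×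
    ¬ Adj G u₁ u₂ ×
    KSeparating G k v u₁ × KSeparating G k v u₂

{-# OPTIONS --safe #-}
module Submission where

-- Fix an arrangement of net cost nc ≤ k and call a gap covered when some edge
-- of length ≥ 2 spans it. An edge of length d spans d ≤ 2(d − 1) gaps, so at
-- most 2 nc ≤ 2k gaps are covered. An uncovered gap c is spanned only by the
-- edge joining positions c and c + 1; it is a bridge and, G being connected,
-- its two sides are the first c + 1 vertices and the remaining ones.
-- So two consecutive uncovered gaps, both at distance ≥ k from the ends, would
-- make the vertex between them k-suppressible. A long edge spanning gap c + 1
-- also spans gap c or c + 2; hence among the n − 1 − 2k middle gaps every
-- uncovered one but the last is followed by two covered ones, and counting gives
-- n ≤ 5k + 2. Finally, the edges of length 1 occupy distinct gaps while the
-- others number at most nc, so |E| ≤ (n − 1) + k ≤ 6k + 1.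

open import Defs
open import Data.Nat using (ℕ; zero; suc; _≤_; _<_; _+_; _*_; _∸_; _⊔_; ∣_-_∣; z≤n; s≤s; z<s; _≟_; _≤?_; _<?_)
open import Data.Product using (Σ; ∃-syntax; _×_; _,_; proj₁; proj₂)
open import Relation.Nullary using (¬_; Dec; yes; no; does)

open import Data.Bool using (Bool; true; T; if_then_else_)
import Data.Bool as Bool
open import Data.Empty using (⊥; ⊥-elim)
open import Data.Fin using (Fin; zero; suc; toℕ; fromℕ<)
open import Data.Fin.Permutation using (_⟨$⟩ʳ_; _⟨$⟩ˡ_; inverseˡ; inverseʳ)
open import Data.Fin.Properties using (any?; toℕ-injective; toℕ<n; toℕ-fromℕ<)
  renaming (_≟_ to _≟ᶠ_; suc-injective to Fin-suc-injective)
open import Data.List using (map; allFin; tabulate)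
open import Data.List.Properties using (map-tabulate)
open import Data.Nat.ListAction using () renaming (sum to sumˡ)
open import Data.Nat.Properties
open import Data.Nat.Tactic.RingSolver using (solve-∀)
open import Data.Sum using (_⊎_; inj₁; inj₂; [_,_]) renaming (swap to ⊎-swap)
open import Data.Unit using (tt)
open import Function using (_∘_; id)
open import Function.Definitions using (Injective)
open import Relation.Binary.Definitions using (tri<; tri≈; tri>)
open import Relation.Binary.PropositionalEquality as ≡ using (_≡_; _≢_; refl; trans; cong; cong₂; subst)
open import Relation.Nullary.Decidable using (_×-dec_; _⊎-dec_; T?; dec-true; dec-false)
open import Relation.Unary using (Decidable)
open import Algebra.Properties.CommutativeSemigroup +-commutativeSemigroup
  using () renaming (interchange to +-interchange)
open import Algebra.Properties.CommutativeMonoid.Sum +-0-commutativeMonoid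
  using (sum-syntax; sum-cong-≗; sum-replicate-zero; sum-remove; ∑-distrib-+)

open ≤-Reasoning

infix 11 [_]·_

[_]·_ : {P : Set} → Dec P → ℕ → ℕ
[ P? ]· x = if does P? then x else 0

𝟙 : {P : Set} → Dec P → ℕ
𝟙 P? = [ P? ]· 1

module _ {P : Set} where

  []·-yes : (P? : Dec P) {x : ℕ} → P → [ P? ]· x ≡ x
  []·-yes (yes _) _  = refl
  []·-yes (no ¬p) p = ⊥-elim (¬p p)

  []·-≤ : (P? : Dec P) {x : ℕ} → [ P? ]· x ≤ x
  []·-≤ (yes _) = ≤-refl
  []·-≤ (no _)  = z≤n

  []·-mono-≤ : (P? : Dec P) {x y : ℕ} → (P → x ≤ y) → [ P? ]· x ≤ [ P? ]· y
  []·-mono-≤ (yes p) x≤y = x≤y p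
  []·-mono-≤ (no _)  _   = z≤n

  []·-+ : (P? : Dec P) (x y : ℕ) → [ P? ]· (x + y) ≡ [ P? ]· x + [ P? ]· y
  []·-+ (yes _) x y = refl
  []·-+ (no _)  x y = refl

  []·-≤-by : (P? : Dec P) {x y : ℕ} → (P → x ≤ y) → [ P? ]· x ≤ y
  []·-≤-by (yes p) x≤y = x≤y p
  []·-≤-by (no _)  _   = z≤n

  []·≢0⇒ : (P? : Dec P) {x : ℕ} → [ P? ]· x ≢ 0 → P
  []·≢0⇒ (yes p) _  = p
  []·≢0⇒ (no _)  ne = ⊥-elim (ne refl)

sumˡ-map-allFin : ∀ {n} (f : Fin n → ℕ) → sumˡ (map f (allFin n)) ≡ ∑[ i < n ] f i
sumˡ-map-allFin f = trans (cong sumˡ (map-tabulate id f)) (sumˡ-tabulate f)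
  where
  sumˡ-tabulate : ∀ {n} (f : Fin n → ℕ) → sumˡ (tabulate f) ≡ ∑[ i < n ] f i
  sumˡ-tabulate {zero}  f = refl
  sumˡ-tabulate {suc n} f = cong (f zero +_) (sumˡ-tabulate (f ∘ suc))

∑-mono-≤ : ∀ {n} {f g : Fin n → ℕ} → (∀ i → f i ≤ g i) → ∑[ i < n ] f i ≤ ∑[ i < n ] g i
∑-mono-≤ {zero}  _   = z≤n
∑-mono-≤ {suc n} f≤g = +-mono-≤ (f≤g zero) (∑-mono-≤ (f≤g ∘ suc))

∑-zero : ∀ {n} {f : Fin n → ℕ} → (∀ i → f i ≡ 0) → ∑[ i < n ] f i ≡ 0
∑-zero {n} f≡0 = trans (sum-cong-≗ f≡0) (sum-replicate-zero n)

≤-∑ : ∀ {n} (f : Fin n → ℕ) i → f i ≤ ∑[ i < n ] f i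
≤-∑ {suc n} f i = subst (f i ≤_) (≡.sym (sum-remove f)) (m≤m+n (f i) _)

∑≢0⇒ : ∀ {n} (f : Fin n → ℕ) → ∑[ i < n ] f i ≢ 0 → ∃[ i ] f i ≢ 0
∑≢0⇒ {zero}  f ne = ⊥-elim (ne refl)
∑≢0⇒ {suc n} f ne with f zero ≟ 0
... | no  f₀≢0 = zero , f₀≢0
... | yes f₀≡0 with ∑≢0⇒ (f ∘ suc) (λ rest≡0 → ne (cong₂ _+_ f₀≡0 rest≡0))
...   | i , fᵢ≢0 = suc i , fᵢ≢0

∑-atMostOne : ∀ {n m} (f : Fin n → ℕ) → (∀ i → f i ≤ m) →
              (∀ i j → f i ≢ 0 → f j ≢ 0 → i ≡ j) → ∑[ i < n ] f i ≤ m
∑-atMostOne {zero}  f _   _      = z≤n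
∑-atMostOne {suc n} {m} f f≤m unique with f zero ≟ 0
... | yes f₀≡0 = subst (λ x → x + ∑[ i < n ] f (suc i) ≤ m) (≡.sym f₀≡0)
  (∑-atMostOne (f ∘ suc) (f≤m ∘ suc) (λ i j fᵢ≢0 fⱼ≢0 → Fin-suc-injective (unique (suc i) (suc j) fᵢ≢0 fⱼ≢0)))
... | no  f₀≢0 = begin
  f zero + ∑[ i < n ] f (suc i) ≡⟨ cong (f zero +_) (∑-zero rest≡0) ⟩
  f zero + 0                    ≡⟨ +-identityʳ (f zero) ⟩
  f zero                        ≤⟨ f≤m zero ⟩
  m                             ∎
  where
  rest≡0 : ∀ i → f (suc i) ≡ 0
  rest≡0 i with f (suc i) ≟ 0
  ... | yes fᵢ≡0 = fᵢ≡0
  ... | no  fᵢ≢0 with unique zero (suc i) f₀≢0 fᵢ≢0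
  ...   | ()

rangeSum : (ℕ → ℕ) → ℕ → ℕ → ℕ
rangeSum g a zero    = 0
rangeSum g a (suc l) = g a + rangeSum g (suc a) l

rangeSum-mono-≤ : ∀ {f g} → (∀ c → f c ≤ g c) → ∀ a l → rangeSum f a l ≤ rangeSum g a l
rangeSum-mono-≤ f≤g a zero    = z≤n
rangeSum-mono-≤ f≤g a (suc l) = +-mono-≤ (f≤g a) (rangeSum-mono-≤ f≤g (suc a) l)

rangeSum-cong : ∀ {f g} → (∀ c → f c ≡ g c) → ∀ a l → rangeSum f a l ≡ rangeSum g a l
rangeSum-cong f≡g a zero    = refl
rangeSum-cong f≡g a (suc l) = cong₂ _+_ (f≡g a) (rangeSum-cong f≡g (suc a) l)

rangeSum-+ : ∀ f g a l → rangeSum (λ c → f c + g c) a l ≡ rangeSum f a l + rangeSum g a l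
rangeSum-+ f g a zero    = refl
rangeSum-+ f g a (suc l) = trans (cong (f a + g a +_) (rangeSum-+ f g (suc a) l))
                                 (+-interchange (f a) (g a) _ _)

rangeSum-const : ∀ m a l → rangeSum (λ _ → m) a l ≡ l * m
rangeSum-const m a zero    = refl
rangeSum-const m a (suc l) = cong (m +_) (rangeSum-const m (suc a) l)

rangeSum-++ : ∀ g a l m → rangeSum g a (l + m) ≡ rangeSum g a l + rangeSum g (a + l) m
rangeSum-++ g a zero    m = cong (λ b → rangeSum g b m) (≡.sym (+-identityʳ a))
rangeSum-++ g a (suc l) m = begin-equality
  g a + rangeSum g (suc a) (l + m)                           ≡⟨ cong (g a +_) (rangeSum-++ g (suc a) l m) ⟩
  g a + (rangeSum g (suc a) l + rangeSum g (suc a + l) m)    ≡⟨ +-assoc (g a) _ _ ⟨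
  g a + rangeSum g (suc a) l + rangeSum g (suc a + l) m      ≡⟨ cong (λ b → g a + rangeSum g (suc a) l + rangeSum g b m) (+-suc a l) ⟨
  g a + rangeSum g (suc a) l + rangeSum g (a + suc l) m      ∎

≤-rangeSum : ∀ g {a c} l → a ≤ c → c < a + l → g c ≤ rangeSum g a l
≤-rangeSum g {a} zero    a≤c c<a+0 = ⊥-elim (<⇒≱ (subst (_ <_) (+-identityʳ a) c<a+0) a≤c)
≤-rangeSum g {a} {c} (suc l) a≤c c<a+l with a ≟ c
... | yes refl = m≤m+n (g a) _
... | no  a≢c  = ≤-trans (≤-rangeSum g l (≤∧≢⇒< a≤c a≢c) (subst (c <_) (+-suc a l) c<a+l))
                         (m≤n+m _ (g a))

rangeSum-[]· : ∀ {P : Set} (P? : Dec P) g a l → rangeSum (λ c → [ P? ]· g c) a l ≡ [ P? ]· rangeSum g a l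
rangeSum-[]· (yes _) g a l = refl
rangeSum-[]· (no _)  g a l = trans (rangeSum-const 0 a l) (*-zeroʳ l)

rangeSum-∑ : ∀ {n} (f : ℕ → Fin n → ℕ) a l →
             rangeSum (λ c → ∑[ i < n ] f c i) a l ≡ ∑[ i < n ] rangeSum (λ c → f c i) a l
rangeSum-∑ {n} f a zero    = ≡.sym (sum-replicate-zero n)
rangeSum-∑ {n} f a (suc l) = trans (cong (∑[ i < n ] f a i +_) (rangeSum-∑ f (suc a) l))
                                   (≡.sym (∑-distrib-+ (f a) _))

rangeSum-interval : ∀ {p q} (in? : ∀ c → Dec (p ≤ c × c < q)) a l →
                    rangeSum (λ c → 𝟙 (in? c)) a l ≤ q ∸ (p ⊔ a)
rangeSum-interval in? a zero = z≤n
rangeSum-interval {p} {q} in? a (suc l) with in? a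
... | yes (p≤a , a<q) = begin
  suc (rangeSum _ (suc a) l) ≤⟨ s≤s (rangeSum-interval in? (suc a) l) ⟩
  suc (q ∸ (p ⊔ suc a))      ≡⟨ cong (λ b → suc (q ∸ b)) (m≤n⇒m⊔n≡n (≤-trans p≤a (n≤1+n a))) ⟩
  suc (q ∸ suc a)            ≡⟨ +-∸-assoc 1 a<q ⟨
  q ∸ a                      ≡⟨ cong (q ∸_) (m≤n⇒m⊔n≡n p≤a) ⟨
  q ∸ (p ⊔ a)                ∎
... | no _ = ≤-trans (rangeSum-interval in? (suc a) l) (∸-monoʳ-≤ q (⊔-monoʳ-≤ p (n≤1+n a)))

rangeSum-⊆ : ∀ g a m r → rangeSum g a m ≤ rangeSum g 0 (a + (m + r))
rangeSum-⊆ g a m r = begin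
  rangeSum g a m                                    ≤⟨ m≤m+n _ _ ⟩
  rangeSum g a m + rangeSum g (a + m) r             ≡⟨ rangeSum-++ g a m r ⟨
  rangeSum g a (m + r)                              ≤⟨ m≤n+m _ _ ⟩
  rangeSum g 0 a + rangeSum g a (m + r)             ≡⟨ rangeSum-++ g 0 a (m + r) ⟨
  rangeSum g 0 (a + (m + r))                        ∎

count : {P : ℕ → Set} → Decidable P → ℕ → ℕ → ℕ
count P? = rangeSum (λ c → 𝟙 (P? c))

private
  2*[k+l]≤3*[j+t]+2 : ∀ {k j l t} → 2 * k ≤ 3 * j → 2 * l ≤ 3 * t + 2 → 2 * (k + l) ≤ 3 * (j + t) + 2
  2*[k+l]≤3*[j+t]+2 {k} {j} {l} {t} 2k≤3j 2l≤3t+2 = begin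
    2 * (k + l)         ≡⟨ *-distribˡ-+ 2 k l ⟩
    2 * k + 2 * l       ≤⟨ +-mono-≤ 2k≤3j 2l≤3t+2 ⟩
    3 * j + (3 * t + 2) ≡⟨ +-assoc (3 * j) (3 * t) 2 ⟨
    3 * j + 3 * t + 2   ≡⟨ cong (_+ 2) (*-distribˡ-+ 3 j t) ⟨
    3 * (j + t) + 2     ∎

-- Together the hypotheses force every ¬P-point of a window inside [A, E),
-- except the last one, to be followed by two P-points.
module _ {P : ℕ → Set} (P? : Decidable P)
         (P-extends : ∀ c → P (suc c) → P c ⊎ P (suc (suc c)))
         {A E : ℕ} (¬P-isolated : ∀ c → A ≤ c → suc c < E → ¬ P c → ¬ P (suc c) → ⊥)
  where

  private
    shift : ∀ {a l} → a + suc l ≤ E → suc a + l ≤ E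
    shift {a} {l} = subst (_≤ E) (+-suc a l)

    next<E : ∀ {a l} → a + suc (suc l) ≤ E → suc a < E
    next<E {a} h = <-≤-trans (m<m+n (suc a) z<s) (shift h)

  2*l≤3*count+2 : ∀ a l → A ≤ a → a + l ≤ E → 2 * l ≤ 3 * count P? a l + 2
  2*l≤3*count+2-after¬P : ∀ a l → ¬ P a → A ≤ a → a + suc l ≤ E → 2 * suc l ≤ 3 * count P? (suc a) l + 2

  2*l≤3*count+2 a zero    _   _ = z≤n
  2*l≤3*count+2 a (suc l) A≤a h with P? a
  ... | yes _  = 2*[k+l]≤3*[j+t]+2 {1} {1} (n≤1+n 2)
                   (2*l≤3*count+2 (suc a) l (m≤n⇒m≤1+n A≤a) (shift h))
  ... | no ¬Pa = 2*l≤3*count+2-after¬P a l ¬Pa A≤a h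

  2*l≤3*count+2-after¬P a zero _ _ _ = ≤-refl
  2*l≤3*count+2-after¬P a (suc zero) ¬Pa A≤a h with P? (suc a)
  ... | yes _    = n≤1+n 4
  ... | no ¬Pa+1 = ⊥-elim (¬P-isolated a A≤a (next<E h) ¬Pa ¬Pa+1)
  2*l≤3*count+2-after¬P a (suc (suc l)) ¬Pa A≤a h with P? (suc a)
  ... | no ¬Pa+1 = ⊥-elim (¬P-isolated a A≤a (next<E h) ¬Pa ¬Pa+1)
  ... | yes Pa+1 with P? (suc (suc a))
  ...   | no ¬Pa+2 = ⊥-elim ([ ¬Pa , ¬Pa+2 ] (P-extends a Pa+1))
  ...   | yes _    = 2*[k+l]≤3*[j+t]+2 {3} {2} ≤-refl
                       (2*l≤3*count+2 (3 + a) l (≤-trans A≤a (m≤n+m a 3))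
                         (shift {suc (suc a)} (shift {suc a} (shift {a} h))))

module _ (G : Graph) where

  Adj-sym : ∀ {x y} → Adj G x y → Adj G y x
  Adj-sym {x} {y} xy = trans (Graph.sym G y x) xy

  Adj-irrefl : ∀ {x} → ¬ Adj G x x
  Adj-irrefl {x} xx with trans (≡.sym xx) (irrefl G x)
  ... | ()

module EdgeSum (G : Graph) where

  OrderedEdge : Vertex G → Vertex G → Set
  OrderedEdge i j = toℕ i < toℕ j × T (adj G i j)

  -- does (orderedEdge? i j) reduces to the test (toℕ i <ᵇ toℕ j) ∧ adj G i j of edgeSum.
  orderedEdge? : ∀ i j → Dec (OrderedEdge i j)
  orderedEdge? i j = (toℕ i <? toℕ j) ×-dec T? (adj G i j)

  Adj⇒T : ∀ {x y} → Adj G x y → T (adj G x y)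
  Adj⇒T a = subst T (≡.sym a) tt

  T⇒Adj : ∀ {x y} → T (adj G x y) → Adj G x y
  T⇒Adj {x} {y} t with adj G x y
  ... | true = refl

  row : (Vertex G → Vertex G → ℕ) → Vertex G → ℕ
  row f i = ∑[ j < n G ] [ orderedEdge? i j ]· f i j

  ∑∑ : (Vertex G → Vertex G → ℕ) → ℕ
  ∑∑ f = ∑[ i < n G ] row f i

  edgeSum≡∑∑ : ∀ f → edgeSum G f ≡ ∑∑ f
  edgeSum≡∑∑ f = trans (sumˡ-map-allFin (λ i → sumˡ (map (term i) (allFin (n G)))))
                       (sum-cong-≗ (λ i → sumˡ-map-allFin (term i)))
    where term = λ i j → [ orderedEdge? i j ]· f i j

  edgeSum-mono-≤ : ∀ {f g} → (∀ {x y} → Adj G x y → f x y ≤ g x y) → edgeSum G f ≤ edgeSum G g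
  edgeSum-mono-≤ {f} {g} f≤g = begin
    edgeSum G f ≡⟨ edgeSum≡∑∑ f ⟩
    ∑∑ f        ≤⟨ ∑-mono-≤ (λ i → ∑-mono-≤ (λ j → []·-mono-≤ (orderedEdge? i j) (f≤g ∘ T⇒Adj ∘ proj₂))) ⟩
    ∑∑ g        ≡⟨ edgeSum≡∑∑ g ⟨
    edgeSum G g ∎

  edgeSum-+ : ∀ f g → edgeSum G (λ x y → f x y + g x y) ≡ edgeSum G f + edgeSum G g
  edgeSum-+ f g = begin-equality
    edgeSum G (λ x y → f x y + g x y) ≡⟨ edgeSum≡∑∑ _ ⟩
    ∑∑ (λ x y → f x y + g x y)       ≡⟨ sum-cong-≗ (λ i → trans (sum-cong-≗ (λ j → []·-+ (orderedEdge? i j) (f i j) (g i j)))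
                                                                (∑-distrib-+ (λ j → [ orderedEdge? i j ]· f i j) _)) ⟩
    ∑[ i < n G ] (row f i + row g i)  ≡⟨ ∑-distrib-+ (row f) (row g) ⟩
    ∑∑ f + ∑∑ g                       ≡⟨ cong₂ _+_ (edgeSum≡∑∑ f) (edgeSum≡∑∑ g) ⟨
    edgeSum G f + edgeSum G g         ∎

  rangeSum-edgeSum : ∀ (h : ℕ → Vertex G → Vertex G → ℕ) a l →
    rangeSum (λ c → edgeSum G (h c)) a l ≡ edgeSum G (λ x y → rangeSum (λ c → h c x y) a l)
  rangeSum-edgeSum h a l = begin-equality
    rangeSum (λ c → edgeSum G (h c)) a l ≡⟨ rangeSum-cong (λ c → edgeSum≡∑∑ (h c)) a l ⟩
    rangeSum (λ c → ∑∑ (h c)) a l        ≡⟨ rangeSum-∑ (λ c → row (h c)) a l ⟩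
    ∑[ i < n G ] rangeSum (λ c → row (h c) i) a l
                                         ≡⟨ sum-cong-≗ (λ i → trans (rangeSum-∑ (λ c j → [ orderedEdge? i j ]· h c i j) a l)
                                              (sum-cong-≗ (λ j → rangeSum-[]· (orderedEdge? i j) (λ c → h c i j) a l))) ⟩
    ∑∑ (λ x y → rangeSum (λ c → h c x y) a l)
                                         ≡⟨ edgeSum≡∑∑ _ ⟨
    edgeSum G (λ x y → rangeSum (λ c → h c x y) a l) ∎

  orderedEdge≤edgeSum : ∀ f {i j} → OrderedEdge i j → f i j ≤ edgeSum G f
  orderedEdge≤edgeSum f {i} {j} e = begin
    f i j                                        ≡⟨ []·-yes (orderedEdge? i j) e ⟨
    [ orderedEdge? i j ]· f i j                  ≤⟨ ≤-∑ _ j ⟩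
    ∑[ j < n G ] [ orderedEdge? i j ]· f i j     ≤⟨ ≤-∑ _ i ⟩
    ∑∑ f                                         ≡⟨ edgeSum≡∑∑ f ⟨
    edgeSum G f                                  ∎

  edge≤edgeSum : ∀ f → (∀ x y → f x y ≡ f y x) → ∀ {x y} → Adj G x y → f x y ≤ edgeSum G f
  edge≤edgeSum f f-sym {x} {y} xy with <-cmp (toℕ x) (toℕ y)
  ... | tri< x<y _ _ = orderedEdge≤edgeSum f (x<y , Adj⇒T xy)
  ... | tri> _ _ y<x = subst (_≤ edgeSum G f) (f-sym y x) (orderedEdge≤edgeSum f (y<x , Adj⇒T (Adj-sym G xy)))
  ... | tri≈ _ x≡y _ = ⊥-elim (Adj-irrefl G (subst (Adj G x) (≡.sym (toℕ-injective x≡y)) xy))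

  private
    orderedEdges-unique : ∀ {i j i′ j′} → OrderedEdge i j → OrderedEdge i′ j′ → SamePair i j i′ j′ → i ≡ i′ × j ≡ j′
    orderedEdges-unique _ _ (inj₁ same) = same
    orderedEdges-unique (i<j , _) (i′<j′ , _) (inj₂ (refl , refl)) = ⊥-elim (<-asym i<j i′<j′)

  edgeSum-atMostOne : ∀ {m} f → (∀ x y → f x y ≤ m) →
    (∀ {x y x′ y′} → Adj G x y → Adj G x′ y′ → f x y ≢ 0 → f x′ y′ ≢ 0 → SamePair x y x′ y′) →
    edgeSum G f ≤ m
  edgeSum-atMostOne {m} f f≤m unique = begin
    edgeSum G f ≡⟨ edgeSum≡∑∑ f ⟩
    ∑∑ f        ≤⟨ ∑-atMostOne (row f) row≤m rows-unique ⟩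
    m           ∎
    where
    term = λ i j → [ orderedEdge? i j ]· f i j

    nonzero⇒edge : ∀ {i j} → term i j ≢ 0 → OrderedEdge i j × f i j ≢ 0
    nonzero⇒edge {i} {j} ne = []·≢0⇒ (orderedEdge? i j) ne ,
                              λ fij≡0 → ne (n≤0⇒n≡0 (subst (term i j ≤_) fij≡0 ([]·-≤ (orderedEdge? i j))))

    terms-unique : ∀ {i j i′ j′} → term i j ≢ 0 → term i′ j′ ≢ 0 → i ≡ i′ × j ≡ j′
    terms-unique ne ne′ with nonzero⇒edge ne | nonzero⇒edge ne′
    ... | e , fne | e′ , fne′ = orderedEdges-unique e e′ (unique (T⇒Adj (proj₂ e)) (T⇒Adj (proj₂ e′)) fne fne′)

    row≤m : ∀ i → row f i ≤ m
    row≤m i = ∑-atMostOne (term i) (λ j → ≤-trans ([]·-≤ (orderedEdge? i j)) (f≤m i j))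
                          (λ j j′ ne ne′ → proj₂ (terms-unique ne ne′))

    rows-unique : ∀ i i′ → row f i ≢ 0 → row f i′ ≢ 0 → i ≡ i′
    rows-unique i i′ ne ne′ with ∑≢0⇒ (term i) ne | ∑≢0⇒ (term i′) ne′
    ... | j , tne | j′ , tne′ = proj₁ (terms-unique tne tne′)

-- Cuts

module _ (G : Graph) where

  samePair? : (x y u v : Vertex G) → Dec (SamePair x y u v)
  samePair? x y u v = ((x ≟ᶠ u) ×-dec (y ≟ᶠ v)) ⊎-dec ((x ≟ᶠ v) ×-dec (y ≟ᶠ u))

  reach-avoiding : ∀ {u v s w} → Reach G s w →
    ReachMinus G u v s w ⊎ ReachMinus G u v u w ⊎ ReachMinus G u v v w
  reach-avoiding here = inj₁ here
  reach-avoiding {u} {v} {s} (step {y = y} sy y⇝w) with reach-avoiding y⇝w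
  ... | inj₂ from-u-or-v = inj₂ from-u-or-v
  ... | inj₁ y⇝w′ with samePair? s y u v
  ...   | no  s≁y               = inj₁ (step sy s≁y y⇝w′)
  ...   | yes (inj₁ (_ , refl)) = inj₂ (inj₂ y⇝w′)
  ...   | yes (inj₂ (_ , refl)) = inj₂ (inj₁ y⇝w′)

  reachMinus-swap : ∀ {u v x z} → ReachMinus G u v x z → ReachMinus G v u x z
  reachMinus-swap here             = here
  reachMinus-swap (step xy x≁y y⇝z) = step xy (x≁y ∘ ⊎-swap) (reachMinus-swap y⇝z)

  SoleCrossing : (Vertex G → Bool) → Vertex G → Vertex G → Set
  SoleCrossing side u v = ∀ {x y} → Adj G x y → side x ≢ side y → SamePair x y u v

  LargeSide : (Vertex G → Bool) → ℕ → Bool → Set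
  LargeSide side k b = Σ (Fin (suc k) → Vertex G) λ f → Injective _≡_ _≡_ f × (∀ i → side (f i) ≡ b)

  module _ {side : Vertex G → Bool} {u v : Vertex G} (sole : SoleCrossing side u v) where

    reachMinus-preserves-side : ∀ {x z} → ReachMinus G u v x z → side x ≡ side z
    reachMinus-preserves-side here = refl
    reachMinus-preserves-side (step {x} {y} xy x≁y y⇝z) with side x Bool.≟ side y
    ... | yes same = trans same (reachMinus-preserves-side y⇝z)
    ... | no  diff = ⊥-elim (x≁y (sole xy diff))

    reachMinus-within-side : Connected G → side u ≢ side v → ∀ {w} → side w ≡ side u → ReachMinus G u v u w
    reachMinus-within-side conn u≉v {w} w~u with reach-avoiding (conn u w)
    ... | inj₁ u⇝w        = u⇝w
    ... | inj₂ (inj₁ u⇝w) = u⇝w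
    ... | inj₂ (inj₂ v⇝w) = ⊥-elim (u≉v (trans (≡.sym w~u) (≡.sym (reachMinus-preserves-side v⇝w))))

  soleCrossing-swap : ∀ {side u v} → SoleCrossing side u v → SoleCrossing side v u
  soleCrossing-swap sole xy diff = ⊎-swap (sole xy diff)

  soleCrossing⇒kSeparating : ∀ {side u v k} → Connected G → Adj G u v → SoleCrossing side u v →
    side u ≢ side v → LargeSide side k (side u) → LargeSide side k (side v) → KSeparating G k u v
  soleCrossing⇒kSeparating conn uv sole u≉v (f , f-inj , f-side) (g , g-inj , g-side) =
    (uv , u≉v ∘ reachMinus-preserves-side sole) ,
    (f , f-inj , λ i → reachMinus-within-side sole conn u≉v (f-side i)) ,
    (g , g-inj , λ i → reachMinus-swap (reachMinus-within-side (soleCrossing-swap sole) conn (u≉v ∘ ≡.sym) (g-side i)))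

-- Gaps of a linear arrangement

∣m-n∣≡[n∸m]+[m∸n] : ∀ m n → ∣ m - n ∣ ≡ (n ∸ m) + (m ∸ n)
∣m-n∣≡[n∸m]+[m∸n] m n with ≤-total m n
... | inj₁ m≤n = begin-equality
  ∣ m - n ∣           ≡⟨ m≤n⇒∣m-n∣≡n∸m m≤n ⟩
  n ∸ m               ≡⟨ +-identityʳ (n ∸ m) ⟨
  (n ∸ m) + 0         ≡⟨ cong ((n ∸ m) +_) (m≤n⇒m∸n≡0 m≤n) ⟨
  (n ∸ m) + (m ∸ n)   ∎
... | inj₂ n≤m = begin-equality
  ∣ m - n ∣           ≡⟨ ∣-∣-comm m n ⟩
  ∣ n - m ∣           ≡⟨ m≤n⇒∣m-n∣≡n∸m n≤m ⟩
  m ∸ n               ≡⟨ cong (_+ (m ∸ n)) (m≤n⇒m∸n≡0 n≤m) ⟨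
  (n ∸ m) + (m ∸ n)   ∎

m≤[m∸1]+[m∸1] : ∀ {m} → 2 ≤ m → m ≤ (m ∸ 1) + (m ∸ 1)
m≤[m∸1]+[m∸1] {suc (suc k)} _ = s≤s (m≤n+m (suc k) k)
m≤[m∸1]+[m∸1] {suc zero} (s≤s ())

private
  3[K+K]+2≡2[3K+1] : ∀ K → 3 * (K + K) + 2 ≡ 2 * (3 * K + 1)
  3[K+K]+2≡2[3K+1] = solve-∀

  K+K+M≡K+[M+K] : ∀ K M → K + K + M ≡ K + (M + K)
  K+K+M≡K+[M+K] = solve-∀

  1+[K+K]+[3K+1]≡5K+2 : ∀ K → suc (K + K) + (3 * K + 1) ≡ 5 * K + 2
  1+[K+K]+[3K+1]≡5K+2 = solve-∀

  5K+1+K≡6K+1 : ∀ K → 5 * K + 1 + K ≡ 6 * K + 1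
  5K+1+K≡6K+1 = solve-∀

module Positions (G : Graph) (α : Arrangement G) where

  open EdgeSum G

  pos : Vertex G → ℕ
  pos v = toℕ (α ⟨$⟩ʳ v)

  pos-injective : ∀ {x y} → pos x ≡ pos y → x ≡ y
  pos-injective e = trans (≡.sym (inverseˡ α)) (trans (cong (α ⟨$⟩ˡ_) (toℕ-injective e)) (inverseˡ α))

  pos<n : ∀ v → pos v < n G
  pos<n v = toℕ<n (α ⟨$⟩ʳ v)

  vertexAt : ∀ p → p < n G → Vertex G
  vertexAt p p<n = α ⟨$⟩ˡ fromℕ< p<n

  pos-vertexAt : ∀ {p} (p<n : p < n G) → pos (vertexAt p p<n) ≡ p
  pos-vertexAt p<n = trans (cong toℕ (inverseʳ α)) (toℕ-fromℕ< p<n)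

  len : Vertex G → Vertex G → ℕ
  len x y = ∣ pos x - pos y ∣

  Long : Vertex G → Vertex G → Set
  Long x y = 2 ≤ len x y

  long? : ∀ x y → Dec (Long x y)
  long? x y = 2 ≤? len x y

  -- Positions are 0-based; gap c is the cut between positions c and c + 1.
  Spans : ℕ → Vertex G → Vertex G → Set
  Spans c x y = pos x ≤ c × c < pos y

  spans? : ∀ c x y → Dec (Spans c x y)
  spans? c x y = (pos x ≤? c) ×-dec (c <? pos y)

  Covered : ℕ → Set
  Covered c = ∃[ x ] ∃[ y ] (Adj G x y × Long x y × Spans c x y)

  covered? : Decidable Covered
  covered? c = any? λ x → any? λ y → (adj G x y Bool.≟ true) ×-dec long? x y ×-dec spans? c x y

  Occupies : ℕ → Vertex G → Vertex G → Set
  Occupies c x y = pos x ≡ c × pos y ≡ suc c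

  AtGap : ℕ → Vertex G → Vertex G → Set
  AtGap c x y = Occupies c x y ⊎ Occupies c y x

  atGap? : ∀ c x y → Dec (AtGap c x y)
  atGap? c x y = ((pos x ≟ c) ×-dec (pos y ≟ suc c)) ⊎-dec ((pos y ≟ c) ×-dec (pos x ≟ suc c))

  samePos : ∀ {x y p} → pos x ≡ p → pos y ≡ p → x ≡ y
  samePos x≡p y≡p = pos-injective (trans x≡p (≡.sym y≡p))

  atGap-samePair : ∀ {c x y x′ y′} → AtGap c x y → AtGap c x′ y′ → SamePair x y x′ y′
  atGap-samePair (inj₁ (x≡ , y≡)) (inj₁ (x′≡ , y′≡)) = inj₁ (samePos x≡ x′≡ , samePos y≡ y′≡)
  atGap-samePair (inj₁ (x≡ , y≡)) (inj₂ (y′≡ , x′≡)) = inj₂ (samePos x≡ y′≡ , samePos y≡ x′≡)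
  atGap-samePair (inj₂ (y≡ , x≡)) (inj₁ (x′≡ , y′≡)) = inj₂ (samePos x≡ y′≡ , samePos y≡ x′≡)
  atGap-samePair (inj₂ (y≡ , x≡)) (inj₂ (y′≡ , x′≡)) = inj₁ (samePos x≡ x′≡ , samePos y≡ y′≡)

  private
    len+pos : ∀ {x y} → pos x ≤ pos y → len x y + pos x ≡ pos y
    len+pos x≤y = trans (cong (_+ _) (m≤n⇒∣m-n∣≡n∸m x≤y)) (m∸n+n≡m x≤y)

  long⇒2+≤ : ∀ {x y} → Long x y → pos x ≤ pos y → 2 + pos x ≤ pos y
  long⇒2+≤ long x≤y = subst (2 + _ ≤_) (len+pos x≤y) (+-monoˡ-≤ _ long)

  short-spanning⇒occupies : ∀ {c x y} → ¬ Long x y → Spans c x y → Occupies c x y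
  short-spanning⇒occupies {c} {x} {y} short (x≤c , c<y) = x≡c , y≡c+1
    where
    y≤1+x : pos y ≤ suc (pos x)
    y≤1+x = subst (_≤ 1 + pos x) (len+pos (≤-trans x≤c (<⇒≤ c<y))) (+-monoˡ-≤ (pos x) (≤-pred (≰⇒> short)))
    x≡c : pos x ≡ c
    x≡c = ≤-antisym x≤c (≤-pred (<-≤-trans c<y y≤1+x))
    y≡c+1 : pos y ≡ suc c
    y≡c+1 = ≤-antisym (subst (λ p → pos y ≤ suc p) x≡c y≤1+x) c<y

  uncovered-spanning⇒occupies : ∀ {c x y} → ¬ Covered c → Adj G x y → Spans c x y → Occupies c x y
  uncovered-spanning⇒occupies ¬cov xy sp = short-spanning⇒occupies (λ long → ¬cov (_ , _ , xy , long , sp)) sp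

  covered-extends : ∀ c → Covered (suc c) → Covered c ⊎ Covered (suc (suc c))
  covered-extends c (x , y , xy , long , x≤c+1 , c+1<y) with pos x ≤? c
  ... | yes x≤c = inj₁ (x , y , xy , long , x≤c , <-trans (n<1+n c) c+1<y)
  ... | no  x≰c = inj₂ (x , y , xy , long , m≤n⇒m≤1+n x≤c+1 , c+2<y)
    where
    c+2<y : suc (suc c) < pos y
    c+2<y = subst (λ p → 2 + p ≤ pos y) (≤-antisym x≤c+1 (≰⇒> x≰c))
                  (long⇒2+≤ long (<⇒≤ (≤-<-trans x≤c+1 c+1<y)))

  walk⇒spanningEdge : ∀ {c s t} → Reach G s t → pos s ≤ c → c < pos t → ∃[ x ] ∃[ y ] (Adj G x y × Spans c x y)
  walk⇒spanningEdge here s≤c c<s = ⊥-elim (<⇒≱ c<s s≤c)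
  walk⇒spanningEdge {c} (step {y = y} sy y⇝t) s≤c c<t with pos y ≤? c
  ... | yes y≤c = walk⇒spanningEdge y⇝t y≤c c<t
  ... | no  y≰c = _ , y , sy , s≤c , ≰⇒> y≰c

  uncovered⇒occupyingEdge : Connected G → ∀ {c} → ¬ Covered c → suc c < n G → ∃[ x ] ∃[ y ] (Adj G x y × Occupies c x y)
  uncovered⇒occupyingEdge conn {c} ¬cov c+1<n =
    let x , y , xy , sp = walk⇒spanningEdge (conn (vertexAt c c<n) (vertexAt (suc c) c+1<n))
                                     (≤-reflexive (pos-vertexAt c<n)) (≤-reflexive (≡.sym (pos-vertexAt c+1<n)))
    in x , y , xy , uncovered-spanning⇒occupies ¬cov xy sp
    where c<n = <-trans (n<1+n c) c+1<n

  coverTerm : ℕ → Vertex G → Vertex G → ℕ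
  coverTerm c x y = [ long? x y ]· (𝟙 (spans? c x y) + 𝟙 (spans? c y x))

  coverTerm-sym : ∀ c x y → coverTerm c x y ≡ coverTerm c y x
  coverTerm-sym c x y = cong₂ (λ d s → [ 2 ≤? d ]· s) (∣-∣-comm (pos x) (pos y)) (+-comm (𝟙 (spans? c x y)) _)

  𝟙-covered≤edgeSum-coverTerm : ∀ c → 𝟙 (covered? c) ≤ edgeSum G (coverTerm c)
  𝟙-covered≤edgeSum-coverTerm c = []·-≤-by (covered? c) λ (x , y , xy , long , sp) → begin
    1                                    ≡⟨ []·-yes (spans? c x y) sp ⟨
    𝟙 (spans? c x y)                     ≤⟨ m≤m+n _ _ ⟩
    𝟙 (spans? c x y) + 𝟙 (spans? c y x)  ≡⟨ []·-yes (long? x y) long ⟨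
    coverTerm c x y                      ≤⟨ edge≤edgeSum (coverTerm c) (coverTerm-sym c) xy ⟩
    edgeSum G (coverTerm c)              ∎

  rangeSum-coverTerm≤2[len∸1] : ∀ l x y → rangeSum (λ c → coverTerm c x y) 0 l ≤ (len x y ∸ 1) + (len x y ∸ 1)
  rangeSum-coverTerm≤2[len∸1] l x y = begin
    rangeSum (λ c → coverTerm c x y) 0 l           ≡⟨ rangeSum-[]· (long? x y) spanCount 0 l ⟩
    [ long? x y ]· rangeSum spanCount 0 l          ≤⟨ []·-≤-by (long? x y) long⇒bound ⟩
    (len x y ∸ 1) + (len x y ∸ 1)                  ∎
    where
    spanCount = λ c → 𝟙 (spans? c x y) + 𝟙 (spans? c y x)
    long⇒bound : Long x y → rangeSum spanCount 0 l ≤ (len x y ∸ 1) + (len x y ∸ 1)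
    long⇒bound long = begin
      rangeSum spanCount 0 l                                                ≡⟨ rangeSum-+ _ _ 0 l ⟩
      rangeSum (λ c → 𝟙 (spans? c x y)) 0 l + rangeSum (λ c → 𝟙 (spans? c y x)) 0 l
                                            ≤⟨ +-mono-≤ (rangeSum-interval (λ c → spans? c x y) 0 l)
                                                        (rangeSum-interval (λ c → spans? c y x) 0 l) ⟩
      (pos y ∸ (pos x ⊔ 0)) + (pos x ∸ (pos y ⊔ 0))  ≡⟨ cong₂ (λ p q → (pos y ∸ p) + (pos x ∸ q)) (⊔-identityʳ (pos x)) (⊔-identityʳ (pos y)) ⟩
      (pos y ∸ pos x) + (pos x ∸ pos y)              ≡⟨ ∣m-n∣≡[n∸m]+[m∸n] (pos x) (pos y) ⟨
      len x y                                        ≤⟨ m≤[m∸1]+[m∸1] long ⟩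
      (len x y ∸ 1) + (len x y ∸ 1)                  ∎

  count-covered≤netCost+netCost : ∀ l → count covered? 0 l ≤ netCost G α + netCost G α
  count-covered≤netCost+netCost l = begin
    count covered? 0 l                                         ≤⟨ rangeSum-mono-≤ 𝟙-covered≤edgeSum-coverTerm 0 l ⟩
    rangeSum (λ c → edgeSum G (coverTerm c)) 0 l               ≡⟨ rangeSum-edgeSum coverTerm 0 l ⟩
    edgeSum G (λ x y → rangeSum (λ c → coverTerm c x y) 0 l)   ≤⟨ edgeSum-mono-≤ (λ {x} {y} _ → rangeSum-coverTerm≤2[len∸1] l x y) ⟩
    edgeSum G (λ x y → (len x y ∸ 1) + (len x y ∸ 1))          ≡⟨ edgeSum-+ _ _ ⟩
    netCost G α + netCost G α                                  ∎

  edgeSum-atGap≤1 : ∀ c → edgeSum G (λ x y → 𝟙 (atGap? c x y)) ≤ 1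
  edgeSum-atGap≤1 c = edgeSum-atMostOne _ (λ x y → []·-≤ (atGap? c x y))
    λ {x} {y} {x′} {y′} _ _ ne ne′ → atGap-samePair ([]·≢0⇒ (atGap? c x y) ne) ([]·≢0⇒ (atGap? c x′ y′) ne′)

  atGaps : Vertex G → Vertex G → ℕ
  atGaps x y = rangeSum (λ c → 𝟙 (atGap? c x y)) 0 (n G ∸ 1)

  atGap⇒1≤atGaps : ∀ {c x y} → AtGap c x y → c < n G ∸ 1 → 1 ≤ atGaps x y
  atGap⇒1≤atGaps {c} {x} {y} at c<L =
    ≤-trans (≤-reflexive (≡.sym ([]·-yes (atGap? c x y) at))) (≤-rangeSum _ (n G ∸ 1) z≤n c<L)

  1≤atGaps+[len∸1] : ∀ {x y} → Adj G x y → 1 ≤ atGaps x y + (len x y ∸ 1)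
  1≤atGaps+[len∸1] {x} {y} xy with long? x y
  ... | yes long  = ≤-trans (∸-monoˡ-≤ 1 long) (m≤n+m _ _)
  ... | no  short with <-cmp (pos x) (pos y)
  ...   | tri< x<y _ _ = ≤-trans (atGap⇒1≤atGaps (inj₁ (short-spanning⇒occupies short (≤-refl , x<y)))
                                                (<-≤-trans x<y (<⇒≤pred (pos<n y))))
                                 (m≤m+n _ _)
  ...   | tri> _ _ y<x = ≤-trans (atGap⇒1≤atGaps (inj₂ (short-spanning⇒occupies (short ∘ subst (2 ≤_) (∣-∣-comm (pos y) (pos x)))
                                                                             (≤-refl , y<x)))
                                                (<-≤-trans y<x (<⇒≤pred (pos<n x))))
                                 (m≤m+n _ _)
  ...   | tri≈ _ x≡y _ = ⊥-elim (Adj-irrefl G (subst (Adj G x) (≡.sym (pos-injective x≡y)) xy))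

  numEdges≤[n∸1]+netCost : numEdges G ≤ (n G ∸ 1) + netCost G α
  numEdges≤[n∸1]+netCost = begin
    numEdges G                                                     ≤⟨ edgeSum-mono-≤ 1≤atGaps+[len∸1] ⟩
    edgeSum G (λ x y → atGaps x y + (len x y ∸ 1))                 ≡⟨ edgeSum-+ atGaps _ ⟩
    edgeSum G atGaps + netCost G α                                 ≡⟨ cong (_+ netCost G α) (rangeSum-edgeSum _ 0 L) ⟨
    rangeSum (λ c → edgeSum G (λ x y → 𝟙 (atGap? c x y))) 0 L + netCost G α
                                                                   ≤⟨ +-monoˡ-≤ (netCost G α) (rangeSum-mono-≤ edgeSum-atGap≤1 0 L) ⟩
    rangeSum (λ _ → 1) 0 L + netCost G α                           ≡⟨ cong (_+ netCost G α) (trans (rangeSum-const 1 0 L) (*-identityʳ L)) ⟩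
    L + netCost G α                                                ∎
    where L = n G ∸ 1

  side : ℕ → Vertex G → Bool
  side c z = does (pos z ≤? c)

  private
    b+i<n : ∀ b {k} → b + k < n G → (i : Fin (suc k)) → b + toℕ i < n G
    b+i<n b b+k<n i = ≤-<-trans (+-monoʳ-≤ b (≤-pred (toℕ<n i))) b+k<n

  block : ∀ b {k} → b + k < n G → Fin (suc k) → Vertex G
  block b b+k<n i = vertexAt (b + toℕ i) (b+i<n b b+k<n i)

  pos-block : ∀ b {k} (b+k<n : b + k < n G) i → pos (block b b+k<n i) ≡ b + toℕ i
  pos-block b b+k<n i = pos-vertexAt (b+i<n b b+k<n i)

  block-injective : ∀ b {k} (b+k<n : b + k < n G) → Injective _≡_ _≡_ (block b b+k<n)
  block-injective b b+k<n {i} {j} e = toℕ-injective (+-cancelˡ-≡ b _ _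
    (trans (≡.sym (pos-block b b+k<n i)) (trans (cong pos e) (pos-block b b+k<n j))))

  left-large : ∀ {c k x} → pos x ≤ c → k ≤ c → c < n G → LargeSide G (side c) k (side c x)
  left-large {c} {k} x≤c k≤c c<n = block 0 k<n , block-injective 0 k<n ,
    λ i → trans (dec-true (_ ≤? c) (subst (_≤ c) (≡.sym (pos-block 0 k<n i)) (≤-trans (≤-pred (toℕ<n i)) k≤c)))
                (≡.sym (dec-true (_ ≤? c) x≤c))
    where k<n = ≤-<-trans k≤c c<n

  right-large : ∀ {c k y} → c < pos y → suc c + k < n G → LargeSide G (side c) k (side c y)
  right-large {c} {k} c<y c+1+k<n = block (suc c) c+1+k<n , block-injective (suc c) c+1+k<n ,
    λ i → trans (dec-false (_ ≤? c) (<⇒≱ (subst (c <_) (≡.sym (pos-block (suc c) c+1+k<n i)) (s≤s (m≤m+n c _)))))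
                (≡.sym (dec-false (_ ≤? c) (<⇒≱ c<y)))

  gap-separating : Connected G → ∀ {c k x y} → ¬ Covered c → Adj G x y → Occupies c x y →
                   k ≤ c → suc c + k < n G → KSeparating G k x y × KSeparating G k y x
  gap-separating conn {c} {k} {x} {y} ¬cov xy occ@(x≡c , y≡c+1) k≤c c+1+k<n =
    soleCrossing⇒kSeparating G conn xy sole x≉y left right ,
    soleCrossing⇒kSeparating G conn (Adj-sym G xy) (soleCrossing-swap G sole) (x≉y ∘ ≡.sym) right left
    where
    x≤c = ≤-reflexive x≡c
    c<y = ≤-reflexive (≡.sym y≡c+1)
    left = left-large x≤c k≤c (≤-<-trans (≤-trans (n≤1+n c) (m≤m+n (suc c) k)) c+1+k<n)
    right = right-large c<y c+1+k<n

    x≉y : side c x ≢ side c y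
    x≉y e with trans (≡.sym (dec-true (pos x ≤? c) x≤c)) (trans e (dec-false (pos y ≤? c) (<⇒≱ c<y)))
    ... | ()

    sole : SoleCrossing G (side c) x y
    sole {x′} {y′} x′y′ diff with pos x′ ≤? c | pos y′ ≤? c
    ... | yes x′≤c | yes y′≤c = ⊥-elim (diff (trans (dec-true (pos x′ ≤? c) x′≤c) (≡.sym (dec-true (pos y′ ≤? c) y′≤c))))
    ... | no  x′≰c | no  y′≰c = ⊥-elim (diff (trans (dec-false (pos x′ ≤? c) x′≰c) (≡.sym (dec-false (pos y′ ≤? c) y′≰c))))
    ... | yes x′≤c | no  y′≰c = atGap-samePair (inj₁ (uncovered-spanning⇒occupies ¬cov x′y′ (x′≤c , ≰⇒> y′≰c))) (inj₁ occ)
    ... | no  x′≰c | yes y′≤c = atGap-samePair (inj₂ (uncovered-spanning⇒occupies ¬cov (Adj-sym G x′y′) (y′≤c , ≰⇒> x′≰c))) (inj₁ occ)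

  between-uncovered-suppressible : Connected G → ∀ {c k a b d} → ¬ Covered c → ¬ Covered (suc c) →
    Adj G a b → Occupies c a b → Adj G b d → Occupies (suc c) b d → k ≤ c → suc (suc c) + k < n G →
    KSuppressible G k b
  between-uncovered-suppressible conn {c} {k} {a} {b} {d} ¬cov₀ ¬cov₁ ab occ₀@(a≡c , b≡c+1) bd occ₁@(_ , d≡c+2) k≤c c+2+k<n =
    a , d , a≢d , Adj-sym G ab , bd , neighbours , ¬ad ,
    proj₂ (gap-separating conn ¬cov₀ ab occ₀ k≤c (<-trans (n<1+n _) c+2+k<n)) ,
    proj₁ (gap-separating conn ¬cov₁ bd occ₁ (m≤n⇒m≤1+n k≤c) c+2+k<n)
    where
    c<c+2 : c < suc (suc c)
    c<c+2 = m≤n⇒m≤1+n (n<1+n c)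

    a≢d : a ≢ d
    a≢d a≡d = <-irrefl (trans (≡.sym a≡c) (trans (cong pos a≡d) d≡c+2)) c<c+2

    ¬ad : ¬ Adj G a d
    ¬ad ad = <-irrefl (trans (≡.sym (proj₂ (uncovered-spanning⇒occupies ¬cov₀ ad (≤-reflexive a≡c , subst (c <_) (≡.sym d≡c+2) c<c+2)))) d≡c+2)
                      (n<1+n (suc c))

    neighbours : ∀ w → Adj G b w → w ≡ a ⊎ w ≡ d
    neighbours w bw with <-cmp (pos w) (suc c)
    ... | tri< w<c+1 _ _ = inj₁ (samePos (proj₁ (uncovered-spanning⇒occupies ¬cov₀ (Adj-sym G bw) (≤-pred w<c+1 , ≤-reflexive (≡.sym b≡c+1)))) a≡c)
    ... | tri≈ _ w≡c+1 _ = ⊥-elim (Adj-irrefl G (subst (Adj G b) (samePos w≡c+1 b≡c+1) bw))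
    ... | tri> _ _ c+1<w = inj₂ (samePos (proj₂ (uncovered-spanning⇒occupies ¬cov₁ bw (≤-reflexive b≡c+1 , c+1<w))) d≡c+2)

  uncovered-pair⇒suppressible : Connected G → ∀ {c k} → ¬ Covered c → ¬ Covered (suc c) → k ≤ c → suc (suc c) + k < n G →
                 ∃[ v ] KSuppressible G k v
  uncovered-pair⇒suppressible conn {c} {k} ¬cov₀ ¬cov₁ k≤c c+2+k<n =
    let a , b , ab , occ₀ = uncovered⇒occupyingEdge conn ¬cov₀ c+1<n
        b′ , d , b′d , b′≡c+1 , d≡c+2 = uncovered⇒occupyingEdge conn ¬cov₁ c+2<n
        bd = subst (λ z → Adj G z d) (samePos b′≡c+1 (proj₂ occ₀)) b′d
    in b , between-uncovered-suppressible conn ¬cov₀ ¬cov₁ ab occ₀ bd (proj₂ occ₀ , d≡c+2) k≤c c+2+k<n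
    where
    c+2<n = ≤-<-trans (m≤m+n (suc (suc c)) k) c+2+k<n
    c+1<n = <-trans (n<1+n (suc c)) c+2<n

  module Bounds (conn : Connected G) {K : ℕ} (noSupp : ∀ v → ¬ KSuppressible G K v) (nc≤K : netCost G α ≤ K) where

    middle≤3K+1 : ∀ M → K + (M + K) < n G → M ≤ 3 * K + 1
    middle≤3K+1 M K+M+K<n = *-cancelˡ-≤ 2 (begin
      2 * M                        ≤⟨ 2*l≤3*count+2 covered? covered-extends uncovered-isolated K M ≤-refl ≤-refl ⟩
      3 * count covered? K M + 2   ≤⟨ +-monoˡ-≤ 2 (*-monoʳ-≤ 3 middle≤2K) ⟩
      3 * (K + K) + 2              ≡⟨ 3[K+K]+2≡2[3K+1] K ⟩
      2 * (3 * K + 1)              ∎)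
      where
      uncovered-isolated : ∀ c → K ≤ c → suc c < K + M → ¬ Covered c → ¬ Covered (suc c) → ⊥
      uncovered-isolated c K≤c c+1<K+M ¬cov₀ ¬cov₁ =
        let v , v-suppressible = uncovered-pair⇒suppressible conn ¬cov₀ ¬cov₁ K≤c
                                   (≤-<-trans (subst (suc (suc c) + K ≤_) (+-assoc K M K) (+-monoˡ-≤ K c+1<K+M)) K+M+K<n)
        in noSupp v v-suppressible

      middle≤2K : count covered? K M ≤ K + K
      middle≤2K = ≤-trans (rangeSum-⊆ _ K M K) (≤-trans (count-covered≤netCost+netCost (K + (M + K))) (+-mono-≤ nc≤K nc≤K))

    n≤5K+2 : n G ≤ 5 * K + 2
    n≤5K+2 with suc (K + K) ≤? n G
    ... | no  2K≮n = ≤-trans (≤-pred (≰⇒> 2K≮n)) (≤-trans (+-monoʳ-≤ K (m≤m+n K _)) (m≤m+n (5 * K) 2))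
    ... | yes 2K<n = begin
      n G                        ≡⟨ m+[n∸m]≡n 2K<n ⟨
      suc (K + K) + M            ≤⟨ +-monoʳ-≤ (suc (K + K)) (middle≤3K+1 M K+[M+K]<n) ⟩
      suc (K + K) + (3 * K + 1)  ≡⟨ 1+[K+K]+[3K+1]≡5K+2 K ⟩
      5 * K + 2                  ∎
      where
      M = n G ∸ suc (K + K)
      K+[M+K]<n : K + (M + K) < n G
      K+[M+K]<n = subst (λ m → suc m ≤ n G) (K+K+M≡K+[M+K] K M) (≤-reflexive (m+[n∸m]≡n 2K<n))

    numEdges≤6K+1 : numEdges G ≤ 6 * K + 1
    numEdges≤6K+1 = begin
      numEdges G                ≤⟨ numEdges≤[n∸1]+netCost ⟩
      (n G ∸ 1) + netCost G α   ≤⟨ +-mono-≤ (∸-monoˡ-≤ 1 n≤5K+2) nc≤K ⟩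
      (5 * K + 2 ∸ 1) + K       ≡⟨ cong (λ m → m ∸ 1 + K) (+-suc (5 * K) 1) ⟩
      5 * K + 1 + K             ≡⟨ 5K+1+K≡6K+1 K ⟩
      6 * K + 1                 ∎

theorem2p10 : (k : ℕ) → (G : Graph) → Connected G →
    (∀ v → ¬ KSuppressible G (suc k) v) →
    (∃[ m ] (IsOlaPlus G m × m ≤ suc k)) →
    (n G ≤ 5 * suc k + 2) × (numEdges G ≤ 6 * suc k + 1)
theorem2p10 k G conn noSupp (_ , ((α , refl) , _) , nc≤K) = n≤5K+2 , numEdges≤6K+1
  where open Positions.Bounds G α conn noSupp nc≤K
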